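{- Let $a$ and $k$ be positive integers and let $D = 2^{2k+2} + 2^{k+2} - 2^{a+2} - 7$. If $0 \le a \le k$ and $D$ is a perfect square, then $k = a = 1$. -}

module Defs where

open import Data.Nat using (ℕ)
open import Data.Integer using (ℤ; +_; _+_; _-_; _*_)
open import Data.Product using (∃)
open import Relation.Binary.PropositionalEquality using (_≡_)

pow2 : ℕ → ℤ
pow2 n = + (2 Data.Nat.^ n)

D : ℕ → ℕ → ℤ
D a k = pow2 (2 Data.Nat.* k Data.Nat.+ 2) + pow2 (k Data.Nat.+ 2) - pow2 (a Data.Nat.+ 2) - + 7

IsSquare : ℤ → Set
IsSquare z = ∃ λ (m : ℤ) → z ≡ m * m

{-# OPTIONS --safe #-}
-- With X = 2^(k+1) and Y = 2^(a+1) we have D = X² + 2X − (2Y + 7).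
-- If a < k then 0 < 2Y + 7 < 2X, so X² < D < (X + 1)² and D is not a square.
-- If a = k then D = X² − 7, and the only squares differing by 7 are 9 and 16,
-- so X = 4, i.e. k = 1.
module Submission where

open import Defs
open import Data.Nat
  using (ℕ; zero; suc; _+_; _*_; _^_; _≤_; _<_; z≤n; s≤s)
open import Data.Nat.Properties
open import Data.Nat.Tactic.RingSolver using (solve-∀)
open import Data.Integer as ℤ using (+_; ∣_∣; -[1+_])
open import Data.Integer.Properties using (+◃n≡+n; pos-+; +-injective)
import Data.Integer.Tactic.RingSolver as ℤ-Solver
open import Data.Product using (_×_; _,_)
open import Data.Sum using (inj₁; inj₂)
open import Relation.Binary.PropositionalEquality
open import Relation.Nullary using (contradiction)

m*m<n*n⇒m<n : ∀ {m n} → m * m < n * n → m < n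
m*m<n*n⇒m<n {m} {n} m²<n² = ≰⇒> λ n≤m → <⇒≱ m²<n² (*-mono-≤ n≤m n≤m)

-- Between x² and (x + 1)² = x² + 2x + 1 there is no room for y² once y > x.
square-gap : ∀ x y d e → x * x + d ≡ y * y + e → e < d → 2 * x + e < d
square-gap x y d e x²+d≡y²+e e<d = +-cancelˡ-≤ (x * x) _ _ x²+[1+2x+e]≤x²+d
  where
  x<y : x < y
  x<y = m*m<n*n⇒m<n (+-cancelʳ-< e _ _ (begin-strict
    x * x + e  <⟨ +-monoʳ-< (x * x) e<d ⟩
    x * x + d  ≡⟨ x²+d≡y²+e ⟩
    y * y + e  ∎))
    where open ≤-Reasoning

  x²+[1+2x+e]≤x²+d : x * x + suc (2 * x + e) ≤ x * x + d
  x²+[1+2x+e]≤x²+d = begin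
    x * x + suc (2 * x + e)  ≡⟨ expand x e ⟩
    suc x * suc x + e        ≤⟨ +-monoˡ-≤ e (*-mono-≤ x<y x<y) ⟩
    y * y + e                ≡⟨ x²+d≡y²+e ⟨
    x * x + d                ∎
    where
    open ≤-Reasoning
    expand : ∀ x e → x * x + suc (2 * x + e) ≡ suc x * suc x + e
    expand = solve-∀

m*m+2m≡n*n+o⇒2m≤o : ∀ m n o → m * m + 2 * m ≡ n * n + o → 2 * m ≤ o
m*m+2m≡n*n+o⇒2m≤o m n o eq = ≮⇒≥ λ o<2m →
  m+n≮m (2 * m) o (square-gap m n (2 * m) o eq o<2m)

m*m+7≡n*n⇒n≤4 : ∀ m n → m * m + 7 ≡ n * n → n ≤ 4
m*m+7≡n*n⇒n≤4 m n eq = <⇒≤pred (m*m<n*n⇒m<n (begin-strict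
  n * n      ≡⟨ eq ⟨
  m * m + 7  ≤⟨ +-monoˡ-≤ 7 (*-mono-≤ m≤3 m≤3) ⟩
  16         <⟨ m≤m+n 17 8 ⟩
  25         ∎))
  where
  open ≤-Reasoning
  2m<7 : 2 * m < 7
  2m<7 = subst (_< 7) (+-identityʳ (2 * m))
    (square-gap m n 7 0 (trans eq (sym (+-identityʳ (n * n)))) (s≤s z≤n))
  m≤3 : m ≤ 3
  m≤3 = *-cancelˡ-≤ 2 (≤-pred 2m<7)

2^[k+2]≡2*2^[1+k] : ∀ k → 2 ^ (k + 2) ≡ 2 * 2 ^ suc k
2^[k+2]≡2*2^[1+k] k = cong (2 ^_) (+-comm k 2)

2^[2k+2]≡2^[1+k]*2^[1+k] : ∀ k → 2 ^ (2 * k + 2) ≡ 2 ^ suc k * 2 ^ suc k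
2^[2k+2]≡2^[1+k]*2^[1+k] k =
  trans (cong (2 ^_) (2k+2≡[1+k]+[1+k] k)) (^-distribˡ-+-* 2 (suc k) (suc k))
  where
  2k+2≡[1+k]+[1+k] : ∀ k → 2 * k + 2 ≡ suc k + suc k
  2k+2≡[1+k]+[1+k] = solve-∀

2^[1+k]≤4⇒k≤1 : ∀ k → 2 ^ suc k ≤ 4 → k ≤ 1
2^[1+k]≤4⇒k≤1 zero          _     = z≤n
2^[1+k]≤4⇒k≤1 (suc zero)    _     = s≤s z≤n
2^[1+k]≤4⇒k≤1 (suc (suc k)) 2^[3+k]≤4 =
  contradiction (≤-trans (^-monoʳ-≤ 2 (m≤m+n 3 k)) 2^[3+k]≤4) (<⇒≱ (m≤m+n 5 3))

2*2^[1+a]+7<2*2^[1+k] : ∀ {a k} → 0 < a → a < k → 2 * 2 ^ suc a + 7 < 2 * 2 ^ suc k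
2*2^[1+a]+7<2*2^[1+k] {a} {k} 0<a a<k = begin-strict
  2 * Y + 7        <⟨ +-monoʳ-< (2 * Y) (^-monoʳ-≤ 2 (s≤s (s≤s 0<a))) ⟩
  2 * Y + 2 * Y    ≡⟨ cong (_+_ (2 * Y)) (+-identityʳ (2 * Y)) ⟨
  2 * (2 * Y)      ≤⟨ *-monoʳ-≤ 2 (^-monoʳ-≤ 2 (s≤s a<k)) ⟩
  2 * 2 ^ suc k    ∎
  where
  open ≤-Reasoning
  Y = 2 ^ suc a

i*i≡+∣i∣*∣i∣ : ∀ i → i ℤ.* i ≡ + (∣ i ∣ * ∣ i ∣)
i*i≡+∣i∣*∣i∣ (+ n)    = +◃n≡+n (n * n)
i*i≡+∣i∣*∣i∣ -[1+ n ] = refl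

+m++n-+o-+p≡+q⇒m+n≡q+[o+p] : ∀ m n o p q →
  + m ℤ.+ + n ℤ.- + o ℤ.- + p ≡ + q → m + n ≡ q + (o + p)
+m++n-+o-+p≡+q⇒m+n≡q+[o+p] m n o p q eq = +-injective (begin
  + (m + n)                                      ≡⟨ pos-+ m n ⟩
  + m ℤ.+ + n                                    ≡⟨ regroup (+ m) (+ n) (+ o) (+ p) ⟩
  (+ m ℤ.+ + n ℤ.- + o ℤ.- + p) ℤ.+ (+ o ℤ.+ + p) ≡⟨ cong₂ ℤ._+_ eq (sym (pos-+ o p)) ⟩
  + q ℤ.+ + (o + p)                              ≡⟨ pos-+ q (o + p) ⟨
  + (q + (o + p))                                ∎)
  where
  open ≡-Reasoning
  regroup : ∀ i j k l → i ℤ.+ j ≡ (i ℤ.+ j ℤ.- k ℤ.- l) ℤ.+ (k ℤ.+ l)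
  regroup = ℤ-Solver.solve-∀

D≡square⇒equation : ∀ a k m → D a k ≡ m ℤ.* m →
  2 ^ suc k * 2 ^ suc k + 2 * 2 ^ suc k ≡ ∣ m ∣ * ∣ m ∣ + (2 * 2 ^ suc a + 7)
D≡square⇒equation a k m D≡m² = begin
  2 ^ suc k * 2 ^ suc k + 2 * 2 ^ suc k
    ≡⟨ cong₂ _+_ (2^[2k+2]≡2^[1+k]*2^[1+k] k) (2^[k+2]≡2*2^[1+k] k) ⟨
  2 ^ (2 * k + 2) + 2 ^ (k + 2)
    ≡⟨ +m++n-+o-+p≡+q⇒m+n≡q+[o+p] (2 ^ (2 * k + 2)) (2 ^ (k + 2))
         (2 ^ (a + 2)) 7 (∣ m ∣ * ∣ m ∣) (trans D≡m² (i*i≡+∣i∣*∣i∣ m)) ⟩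
  ∣ m ∣ * ∣ m ∣ + (2 ^ (a + 2) + 7)
    ≡⟨ cong (λ y → ∣ m ∣ * ∣ m ∣ + (y + 7)) (2^[k+2]≡2*2^[1+k] a) ⟩
  ∣ m ∣ * ∣ m ∣ + (2 * 2 ^ suc a + 7)
    ∎
  where open ≡-Reasoning

lemma4 : (a k : ℕ) → 0 < a → 0 < k → a ≤ k → IsSquare (D a k) → (k ≡ 1) × (a ≡ 1)
lemma4 a k 0<a 0<k a≤k (m , D≡m²) with m≤n⇒m<n∨m≡n a≤k
... | inj₁ a<k = contradiction
  (m*m+2m≡n*n+o⇒2m≤o (2 ^ suc k) ∣ m ∣ _ (D≡square⇒equation a k m D≡m²))
  (<⇒≱ (2*2^[1+a]+7<2*2^[1+k] 0<a a<k))
... | inj₂ refl = k≡1 , k≡1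
  where
  X = 2 ^ suc k
  n = ∣ m ∣
  n²+7≡X² : n * n + 7 ≡ X * X
  n²+7≡X² = +-cancelʳ-≡ (2 * X) _ _ (begin
    n * n + 7 + 2 * X    ≡⟨ +-assoc (n * n) 7 (2 * X) ⟩
    n * n + (7 + 2 * X)  ≡⟨ cong (_+_ (n * n)) (+-comm 7 (2 * X)) ⟩
    n * n + (2 * X + 7)  ≡⟨ D≡square⇒equation k k m D≡m² ⟨
    X * X + 2 * X        ∎)
    where open ≡-Reasoning
  k≡1 : k ≡ 1
  k≡1 = ≤-antisym (2^[1+k]≤4⇒k≤1 k (m*m+7≡n*n⇒n≤4 n X n²+7≡X²)) 0<k
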